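{- There exists a backward simulation from $TS_{PSO}$ to $TS_{PP}$, i.e.\ a relation $B\subseteq\Sigma_{PSO}\times\Sigma_{PP}$, total on $\Sigma_{PSO}$, with $B(\sigma_0)\subseteq I_{PP}$ for all $\sigma_0\in I_{PSO}$, such that for all threads $t$ and all $a\in{\sf Act}$: $(\sigma_1',\sigma_2')\in B\land(\sigma_1,\sigma_1')\in T_{PSO}(t,a)\Rightarrow\exists\sigma_2:(\sigma_2,\sigma_2')\in T_{PP}(t,a)\land(\sigma_1,\sigma_2)\in B$.
   Context: Programs run over threads $\mathsf{Tid}$, global variables ${\sf Var_G}$, local registers ${\sf Var_L}$, values ${\sf Val}$; actions are ${\sf Act}=\{rd(x,r,v),wr(x,v),fence\}$. Relational composition is written $R\,;\,R'$ (first $R$, then $R'$). PSO: states $(s,wb)\in\Sigma_{PSO}$ with shared memory $s:{\sf Var_G}\to{\sf Val}$ and a FIFO write buffer $wb^{t,x}\in{\sf Val}^*$ for each thread $t$ and variable $x$. A write $wr(x,v)$ by $t$ appends $v$ to $wb^{t,x}$; a read $rd(x,r,v)$ by $t$ requires $v$ to be the last entry of $wb^{t,x}$ if nonempty, else $s(x)$, state unchanged; a fence by $t$ requires all $wb^{t,x}$ empty, state unchanged; a flush step of $t$ removes the first entry $v$ of some $wb^{t,x}$ and sets $s(x):=v$. $I_{PSO}$: all buffers empty. $T_{PSO}(t,a)=FL_{PSO}\,;\,\overset{a,t}{\leadsto}_{PSO}$ with $FL_{PSO}$ the reflexive-transitive closure of all flush steps. PPSO: states $(s,wb)\in\Sigma_{PP}$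 with $wb^{t,x}\in({\sf Val}\times\mathbb{Q})^*$. PP-Write appends $(v,q)$ to $wb^{t,x}$ provided $q$ occurs as timestamp in no buffer and exceeds all timestamps in $wb^{t,x}$. PP-Read requires $v$ = value of last entry of $wb^{t,x}$ if nonempty, else $s(x)$; state unchanged. PP-Fence requires all buffers of $t$ empty. PP-Flush of $t$: if $wb^{t,x}=\langle(v,q)\rangle\cdot w$ and $q$ is smaller than every timestamp in every other buffer, set $s(x):=v$, $wb^{t,x}:=w$. $I_{PP}$: all buffers empty. $FL_{PP}=(\bigcup_t\overset{flush,t}{\leadsto}_{PP})^*$, $T_{PP}(t,a)=FL_{PP}\,;\,\overset{a,t}{\leadsto}_{PP}$. -}

module Defs where

open import Data.Nat using (ℕ)
open import Data.Fin using (Fin)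
open import Data.List using (List; []; _∷_; _++_; [_]; map)
open import Data.List.Relation.Unary.All using (All)
open import Data.List.Relation.Unary.Any using (Any)
open import Data.Product using (Σ; ∃; _×_; _,_; proj₁; proj₂)
open import Data.Rational using (ℚ; _<_)
open import Relation.Binary.PropositionalEquality using (_≡_; _≢_)
open import Relation.Binary.Construct.Closure.ReflexiveTransitive using (Star)
open import Relation.Nullary using (¬_)

_⨾_ : {A : Set} → (A → A → Set) → (A → A → Set) → A → A → Set
(R ⨾ R') a c = ∃ λ b → R a b × R' b c

readVal : {V : Set} → List V → V → V
readVal []      d = d
readVal (v ∷ w) d = readVal w v

module Model (m n : ℕ) (VarL Val : Set) where

  Tid : Set
  Tid = Fin m

  VarG : Set
  VarG = Fin n

  data Act : Set where
    rd    : VarG → VarL → Val → Act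
    wr    : VarG → Val → Act
    fence : Act

  record ΣPSO : Set where
    constructor ⟨_,_⟩ₚ
    field
      s  : VarG → Val
      wb : Tid → VarG → List Val
  open ΣPSO public

  _≈ₚ_ : ΣPSO → ΣPSO → Set
  σ ≈ₚ σ' = (∀ x → s σ x ≡ s σ' x) × (∀ t x → wb σ t x ≡ wb σ' t x)

  IPSO : ΣPSO → Set
  IPSO σ = ∀ t x → wb σ t x ≡ []

  stepPSO : Tid → Act → ΣPSO → ΣPSO → Set
  stepPSO t (wr x v) σ σ' =
      (∀ y → s σ' y ≡ s σ y)
    × wb σ' t x ≡ wb σ t x ++ [ v ]
    × (∀ t' y → ¬ (t' ≡ t × y ≡ x) → wb σ' t' y ≡ wb σ t' y)
  stepPSO t (rd x r v) σ σ' = v ≡ readVal (wb σ t x) (s σ x) × σ' ≈ₚ σ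
  stepPSO t fence σ σ' = (∀ x → wb σ t x ≡ []) × σ' ≈ₚ σ

  flushPSO : Tid → ΣPSO → ΣPSO → Set
  flushPSO t σ σ' = Σ VarG λ x → Σ Val λ v → Σ (List Val) λ w →
      wb σ t x ≡ v ∷ w
    × wb σ' t x ≡ w
    × s σ' x ≡ v
    × (∀ y → y ≢ x → s σ' y ≡ s σ y)
    × (∀ t' y → ¬ (t' ≡ t × y ≡ x) → wb σ' t' y ≡ wb σ t' y)

  FLPSO : ΣPSO → ΣPSO → Set
  FLPSO = Star (λ σ σ' → Σ Tid λ t → flushPSO t σ σ')

  TPSO : Tid → Act → ΣPSO → ΣPSO → Set
  TPSO t a = FLPSO ⨾ stepPSO t a

  record ΣPP : Set where
    constructor ⟨_,_⟩ₚₚ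
    field
      sp  : VarG → Val
      wbp : Tid → VarG → List (Val × ℚ)
  open ΣPP public

  _≈ₚₚ_ : ΣPP → ΣPP → Set
  σ ≈ₚₚ σ' = (∀ x → sp σ x ≡ sp σ' x) × (∀ t x → wbp σ t x ≡ wbp σ' t x)

  IPP : ΣPP → Set
  IPP σ = ∀ t x → wbp σ t x ≡ []

  stepPP : Tid → Act → ΣPP → ΣPP → Set
  stepPP t (wr x v) σ σ' = Σ ℚ λ q →
      (∀ t' y → ¬ Any (λ e → proj₂ e ≡ q) (wbp σ t' y))
    × All (λ e → proj₂ e < q) (wbp σ t x)
    × (∀ y → sp σ' y ≡ sp σ y)
    × wbp σ' t x ≡ wbp σ t x ++ [ (v , q) ]
    × (∀ t' y → ¬ (t' ≡ t × y ≡ x) → wbp σ' t' y ≡ wbp σ t' y)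
  stepPP t (rd x r v) σ σ' =
    v ≡ readVal (map proj₁ (wbp σ t x)) (sp σ x) × σ' ≈ₚₚ σ
  stepPP t fence σ σ' = (∀ x → wbp σ t x ≡ []) × σ' ≈ₚₚ σ

  flushPP : Tid → ΣPP → ΣPP → Set
  flushPP t σ σ' = Σ VarG λ x → Σ Val λ v → Σ ℚ λ q → Σ (List (Val × ℚ)) λ w →
      wbp σ t x ≡ (v , q) ∷ w
    × (∀ t' y → ¬ (t' ≡ t × y ≡ x) → All (λ e → q < proj₂ e) (wbp σ t' y))
    × wbp σ' t x ≡ w
    × sp σ' x ≡ v
    × (∀ y → y ≢ x → sp σ' y ≡ sp σ y)
    × (∀ t' y → ¬ (t' ≡ t × y ≡ x) → wbp σ' t' y ≡ wbp σ t' y)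

  FLPP : ΣPP → ΣPP → Set
  FLPP = Star (λ σ σ' → Σ Tid λ t → flushPP t σ σ')

  TPP : Tid → Act → ΣPP → ΣPP → Set
  TPP t a = FLPP ⨾ stepPP t a

{-# OPTIONS --safe #-}
-- A PPSO state represents a PSO state when it has the same memory and the same
-- buffers up to timestamps, the timestamps ascending within each buffer and never
-- shared between two buffers.  The simulation runs backwards: undoing a write
-- drops the last entry of the PPSO buffer, and undoing a flush puts the value back
-- at the head of its buffer under a timestamp below every timestamp in use, which
-- is exactly what makes the recovered PPSO flush enabled.  Every PSO state is
-- represented: the i-th entry of buffer number c gets timestamp c + i·(m·n).
module Submission where

open import Defs
open import Data.Nat using (ℕ)
open import Data.Product using (Σ; ∃; _×_; _,_)

import Data.Nat as ℕ
import Data.Nat.Properties as ℕP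
open import Data.Nat.DivMod using (_%_; [m+kn]%n≡m%n; m<n⇒m%n≡m)
open import Data.Nat.Coprimality using (1-coprimeTo) renaming (sym to coprime-sym)
import Data.Integer as ℤ
import Data.Integer.Properties as ℤP
open import Data.Rational using (ℚ; mkℚ; _<_; _⊓_; _-_; 0ℚ; 1ℚ; *<*)
import Data.Rational.Properties as ℚP
open import Data.Fin using (toℕ; combine; _≟_)
open import Data.Fin.Properties using (toℕ-injective; toℕ<n; combine-injective)
open import Data.List using (List; []; _∷_; _∷ʳ_; map; concatMap; allFin)
open import Data.List.Properties using (∷-injective)
open import Data.List.Membership.Propositional.Properties using (∈-allFin)
open import Data.List.Relation.Unary.All as All using (All; []; _∷_)
open import Data.List.Relation.Unary.All.Properties using (All¬⇒¬Any; concat⁻; map⁻; ∷ʳ⁻)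
open import Data.List.Relation.Unary.AllPairs using (AllPairs; []; _∷_)
open import Data.List.Relation.Unary.Any using (Any; here; there)
open import Data.List.Relation.Unary.Any.Properties using (++⁺ˡ; ++⁺ʳ)
open import Data.Product using (proj₁; proj₂)
open import Data.Empty using (⊥-elim)
open import Function using (_∘_)
open import Relation.Nullary using (¬_; Dec; yes; no)
open import Relation.Nullary.Decidable using (_×-dec_)
open import Relation.Binary.PropositionalEquality
  using (_≡_; ≢-sym; refl; sym; trans; cong; cong₂; subst; subst₂; module ≡-Reasoning)
open import Relation.Binary.Construct.Closure.ReflexiveTransitive using (ε; _◅_)

map≡[]⇒≡[] : ∀ {A B : Set} {f : A → B} (xs : List A) → map f xs ≡ [] → xs ≡ []
map≡[]⇒≡[] [] _ = refl

map≡∷ʳ⁻ : ∀ {A B : Set} {f : A → B} (xs : List A) (ys : List B) {y : B} →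
  map f xs ≡ ys ∷ʳ y →
  ∃ λ xs′ → ∃ λ x → xs ≡ xs′ ∷ʳ x × map f xs′ ≡ ys × f x ≡ y
map≡∷ʳ⁻ [] [] ()
map≡∷ʳ⁻ [] (_ ∷ _) ()
map≡∷ʳ⁻ (x ∷ xs) [] eq with ∷-injective eq
... | fx≡y , mapxs≡[] rewrite map≡[]⇒≡[] xs mapxs≡[] = [] , x , refl , refl , fx≡y
map≡∷ʳ⁻ (x ∷ xs) (_ ∷ ys) eq with ∷-injective eq
... | refl , eq′ with map≡∷ʳ⁻ xs ys eq′
...   | xs′ , z , refl , refl , fz≡y = x ∷ xs′ , z , refl , refl , fz≡y

AllPairs-∷ʳ⁻ : ∀ {A : Set} {R : A → A → Set} (xs : List A) {x : A} →
  AllPairs R (xs ∷ʳ x) → AllPairs R xs × All (λ y → R y x) xs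
AllPairs-∷ʳ⁻ [] _ = [] , []
AllPairs-∷ʳ⁻ (y ∷ xs) (Ry ∷ pairs) with ∷ʳ⁻ Ry | AllPairs-∷ʳ⁻ xs pairs
... | Ryxs , Ryx | pairsxs , Rxs = (Ryxs ∷ pairsxs) , (Ryx ∷ Rxs)

All-concatMap⁻ : ∀ {A B : Set} {P : B → Set} {f : A → List B} (xs : List A) →
  All P (concatMap f xs) → All (λ x → All P (f x)) xs
All-concatMap⁻ xs = map⁻ ∘ concat⁻

m+kn≡o+ln⇒m≡o : ∀ {m k o l n} → m ℕ.< n → o ℕ.< n → m ℕ.+ k ℕ.* n ≡ o ℕ.+ l ℕ.* n → m ≡ o
m+kn≡o+ln⇒m≡o {m} {k} {o} {l} {n} m<n o<n eq = begin
  m                  ≡⟨ sym (m<n⇒m%n≡m m<n) ⟩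
  m % n              ≡⟨ sym ([m+kn]%n≡m%n m k n) ⟩
  (m ℕ.+ k ℕ.* n) % n ≡⟨ cong (_% n) eq ⟩
  (o ℕ.+ l ℕ.* n) % n ≡⟨ [m+kn]%n≡m%n o l n ⟩
  o % n              ≡⟨ m<n⇒m%n≡m o<n ⟩
  o                  ∎
  where
  open ≡-Reasoning
  instance
    n≢0 : ℕ.NonZero n
    n≢0 = ℕ.>-nonZero (ℕP.m<n⇒0<n m<n)

fromℕ : ℕ → ℚ
fromℕ k = mkℚ (ℤ.+ k) 0 (coprime-sym (1-coprimeTo k))

fromℕ-injective : ∀ {a b} → fromℕ a ≡ fromℕ b → a ≡ b
fromℕ-injective eq = cong (λ p → ℤ.∣ ℚ.numerator p ∣) eq

fromℕ-mono-< : ∀ {a b} → a ℕ.< b → fromℕ a < fromℕ b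
fromℕ-mono-< {a} {b} a<b =
  *<* (subst₂ ℤ._<_ (sym (ℤP.*-identityʳ (ℤ.+ a))) (sym (ℤP.*-identityʳ (ℤ.+ b))) (ℤ.+<+ a<b))

p-1<p : ∀ p → p - 1ℚ < p
p-1<p p = subst (p - 1ℚ <_) (ℚP.+-identityʳ p) (ℚP.+-monoʳ-< p (*<* ℤ.-<+))

∃-strictLowerBound : (ps : List ℚ) → ∃ λ q → All (q <_) ps
∃-strictLowerBound [] = 0ℚ , []
∃-strictLowerBound (p ∷ ps) with ∃-strictLowerBound ps
... | q , q<ps =
  (p - 1ℚ) ⊓ q ,
  ℚP.≤-<-trans (ℚP.p⊓q≤p (p - 1ℚ) q) (p-1<p p) ∷
  All.map (ℚP.≤-<-trans (ℚP.p⊓q≤q (p - 1ℚ) q)) q<ps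

module BackwardSimulation (m n : ℕ) (VarL Val : Set) where
  open Model m n VarL Val

  Entry : Set
  Entry = Val × ℚ

  Buffers : Set
  Buffers = Tid → VarG → List Entry

  HasStamp : ℚ → List Entry → Set
  HasStamp q = Any (λ e → proj₂ e ≡ q)

  Ascending : List Entry → Set
  Ascending = AllPairs (λ e e′ → proj₂ e < proj₂ e′)

  record WellStamped (W : Buffers) : Set where
    field
      ascending : ∀ t x → Ascending (W t x)
      disjoint  : ∀ t x t′ y → ¬ (t′ ≡ t × y ≡ x) →
                  ∀ {q} → HasStamp q (W t x) → ¬ HasStamp q (W t′ y)
  open WellStamped

  record Represents (σ₁ : ΣPSO) (σ₂ : ΣPP) : Set where
    constructor represents
    field
      memory      : ∀ x → sp σ₂ x ≡ s σ₁ x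
      values      : ∀ t x → map proj₁ (wbp σ₂ t x) ≡ wb σ₁ t x
      wellStamped : WellStamped (wbp σ₂)
  open Represents

  sameBuffer? : ∀ (t : Tid) (x : VarG) t′ y → Dec (t′ ≡ t × y ≡ x)
  sameBuffer? t x t′ y = (t′ ≟ t) ×-dec (y ≟ x)

  update : {A : Set} → (Tid → VarG → A) → Tid → VarG → A → Tid → VarG → A
  update f t x a t′ y with sameBuffer? t x t′ y
  ... | yes _ = a
  ... | no _  = f t′ y

  update-same : ∀ {A : Set} (f : Tid → VarG → A) t x a → update f t x a t x ≡ a
  update-same f t x a with sameBuffer? t x t x
  ... | yes _ = refl
  ... | no ne = ⊥-elim (ne (refl , refl))

  update-other : ∀ {A : Set} (f : Tid → VarG → A) t x a t′ y →
    ¬ (t′ ≡ t × y ≡ x) → update f t x a t′ y ≡ f t′ y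
  update-other f t x a t′ y ne with sameBuffer? t x t′ y
  ... | yes same = ⊥-elim (ne same)
  ... | no _     = refl

  update-∀ : ∀ {A : Set} (P : Tid → VarG → A → Set) {f : Tid → VarG → A} {t x a} →
    P t x a → (∀ t′ y → ¬ (t′ ≡ t × y ≡ x) → P t′ y (f t′ y)) →
    ∀ t′ y → P t′ y (update f t x a t′ y)
  update-∀ P {f} {t} {x} {a} Pa Pf t′ y with sameBuffer? t x t′ y
  ... | yes (refl , refl) = Pa
  ... | no ne             = Pf t′ y ne

  wellStamped-update : ∀ {W t x L} → WellStamped W → Ascending L →
    (∀ t′ y → ¬ (t′ ≡ t × y ≡ x) → ∀ {q} → HasStamp q L → ¬ HasStamp q (W t′ y)) →
    WellStamped (update W t x L)
  wellStamped-update {W} {t} {x} {L} ws ascL fresh = record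
    { ascending = update-∀ (λ _ _ → Ascending) ascL (λ t′ y _ → ascending ws t′ y)
    ; disjoint  = disjoint′
    }
    where
    disjoint′ : ∀ t₁ x₁ t₂ x₂ → ¬ (t₂ ≡ t₁ × x₂ ≡ x₁) → ∀ {q} →
      HasStamp q (update W t x L t₁ x₁) → ¬ HasStamp q (update W t x L t₂ x₂)
    disjoint′ t₁ x₁ t₂ x₂ ne with sameBuffer? t x t₁ x₁ | sameBuffer? t x t₂ x₂
    ... | yes (refl , refl) | yes (refl , refl) = ⊥-elim (ne (refl , refl))
    ... | yes (refl , refl) | no ne₂ = fresh t₂ x₂ ne₂
    ... | no ne₁ | yes (refl , refl) = λ h₁ h₂ → fresh t₁ x₁ ne₁ h₂ h₁
    ... | no ne₁ | no ne₂ = disjoint ws t₁ x₁ t₂ x₂ ne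

  ∃-stampBelowAll : ∀ (W : Buffers) → ∃ λ q → ∀ t y → All (λ e → q < proj₂ e) (W t y)
  ∃-stampBelowAll W =
    q , λ t y → map⁻ (All.lookup (All.lookup perThread (∈-allFin t)) (∈-allFin y))
    where
    stamps : List ℚ
    stamps = concatMap (λ t → concatMap (λ y → map proj₂ (W t y)) (allFin n)) (allFin m)

    q : ℚ
    q = proj₁ (∃-strictLowerBound stamps)

    perThread : All (λ t → All (λ y → All (q <_) (map proj₂ (W t y))) (allFin n)) (allFin m)
    perThread = All.map (All-concatMap⁻ (allFin n))
      (All-concatMap⁻ (allFin m) (proj₂ (∃-strictLowerBound stamps)))

  represents-resp-≈ : ∀ {σ σ′ σ₂} → σ′ ≈ₚ σ → Represents σ′ σ₂ → Represents σ σ₂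
  represents-resp-≈ (s≡ , wb≡) r = represents
    (λ x → trans (memory r x) (s≡ x))
    (λ t x → trans (values r t x) (wb≡ t x))
    (wellStamped r)

  ≈ₚₚ-refl : ∀ {σ} → σ ≈ₚₚ σ
  ≈ₚₚ-refl = (λ _ → refl) , (λ _ _ → refl)

  write-back : ∀ t x v σ σ′ σ₂′ → Represents σ′ σ₂′ → stepPSO t (wr x v) σ σ′ →
    ∃ λ σ₂ → stepPP t (wr x v) σ₂ σ₂′ × Represents σ σ₂
  write-back t x v σ σ′ σ₂′ r (s≡ , wb≡ , wbOther)
    with map≡∷ʳ⁻ (wbp σ₂′ t x) (wb σ t x) (trans (values r t x) wb≡)
  ... | pre , (.v , q) , split , values-pre , refl =
    σ₂ , (q , fresh , pre<q , (λ y → trans (memory r y) (s≡ y)) , appended , unchanged) , r₂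
    where
    σ₂ : ΣPP
    σ₂ = ⟨ s σ , update (wbp σ₂′) t x pre ⟩ₚₚ

    asc-pre : Ascending pre × All (λ e → proj₂ e < q) pre
    asc-pre = AllPairs-∷ʳ⁻ pre (subst Ascending split (ascending (wellStamped r) t x))

    pre<q : All (λ e → proj₂ e < q) (wbp σ₂ t x)
    pre<q = subst (All (λ e → proj₂ e < q)) (sym (update-same _ t x pre)) (proj₂ asc-pre)

    q∈last : HasStamp q (wbp σ₂′ t x)
    q∈last = subst (HasStamp q) (sym split) (++⁺ʳ pre (here refl))

    fresh : ∀ t′ y → ¬ HasStamp q (wbp σ₂ t′ y)
    fresh = update-∀ (λ _ _ w → ¬ HasStamp q w)
      (All¬⇒¬Any (All.map ℚP.<⇒≢ (proj₂ asc-pre)))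
      (λ t′ y ne → disjoint (wellStamped r) t x t′ y ne q∈last)

    appended : wbp σ₂′ t x ≡ wbp σ₂ t x ∷ʳ (v , q)
    appended = trans split (cong (_∷ʳ (v , q)) (sym (update-same _ t x pre)))

    unchanged : ∀ t′ y → ¬ (t′ ≡ t × y ≡ x) → wbp σ₂′ t′ y ≡ wbp σ₂ t′ y
    unchanged t′ y ne = sym (update-other _ t x pre t′ y ne)

    r₂ : Represents σ σ₂
    r₂ = represents (λ _ → refl)
      (update-∀ (λ t′ y w → map proj₁ w ≡ wb σ t′ y) values-pre
        (λ t′ y ne → trans (values r t′ y) (wbOther t′ y ne)))
      (wellStamped-update (wellStamped r) (proj₁ asc-pre)
        (λ t′ y ne h → disjoint (wellStamped r) t x t′ y ne
          (subst (HasStamp _) (sym split) (++⁺ˡ h))))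

  step-back : ∀ t a σ σ′ σ₂′ → Represents σ′ σ₂′ → stepPSO t a σ σ′ →
    ∃ λ σ₂ → stepPP t a σ₂ σ₂′ × Represents σ σ₂
  step-back t (wr x v) σ σ′ σ₂′ r step = write-back t x v σ σ′ σ₂′ r step
  step-back t (rd x _ v) σ σ′ σ₂′ r (v≡ , σ′≈σ) =
    σ₂′ , (trans v≡ (sym (cong₂ readVal (values r′ t x) (memory r′ x))) , ≈ₚₚ-refl) , r′
    where
    r′ = represents-resp-≈ σ′≈σ r
  step-back t fence σ σ′ σ₂′ r (empty , σ′≈σ) =
    σ₂′ , ((λ x → map≡[]⇒≡[] _ (trans (values r′ t x) (empty x))) , ≈ₚₚ-refl) , r′
    where
    r′ = represents-resp-≈ σ′≈σ r

  flush-back : ∀ t σ σ′ σ₂′ → Represents σ′ σ₂′ → flushPSO t σ σ′ →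
    ∃ λ σ₂ → flushPP t σ₂ σ₂′ × Represents σ σ₂
  flush-back t σ σ′ σ₂′ r (x , v , w , wb≡v∷w , wb′≡w , s′≡v , sOther , wbOther) =
    σ₂ ,
    (x , v , q , W t x , update-same W t x L , q<others , refl ,
     trans (memory r x) s′≡v , (λ y y≢x → trans (memory r y) (sOther y y≢x)) , unchanged) ,
    r₂
    where
    W : Buffers
    W = wbp σ₂′

    q : ℚ
    q = proj₁ (∃-stampBelowAll W)

    q<W : ∀ t′ y → All (λ e → q < proj₂ e) (W t′ y)
    q<W = proj₂ (∃-stampBelowAll W)

    L : List Entry
    L = (v , q) ∷ W t x

    σ₂ : ΣPP
    σ₂ = ⟨ s σ , update W t x L ⟩ₚₚ

    q<others : ∀ t′ y → ¬ (t′ ≡ t × y ≡ x) → All (λ e → q < proj₂ e) (wbp σ₂ t′ y)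
    q<others t′ y ne = subst (All (λ e → q < proj₂ e)) (sym (update-other W t x L t′ y ne)) (q<W t′ y)

    unchanged : ∀ t′ y → ¬ (t′ ≡ t × y ≡ x) → W t′ y ≡ wbp σ₂ t′ y
    unchanged t′ y ne = sym (update-other W t x L t′ y ne)

    fresh : ∀ t′ y → ¬ (t′ ≡ t × y ≡ x) → ∀ {q′} → HasStamp q′ L → ¬ HasStamp q′ (W t′ y)
    fresh t′ y ne (here refl) = All¬⇒¬Any (All.map (≢-sym ∘ ℚP.<⇒≢) (q<W t′ y))
    fresh t′ y ne (there h) = disjoint (wellStamped r) t x t′ y ne h

    r₂ : Represents σ σ₂
    r₂ = represents (λ _ → refl)
      (update-∀ (λ t′ y w → map proj₁ w ≡ wb σ t′ y)
        (trans (cong (v ∷_) (trans (values r t x) wb′≡w)) (sym wb≡v∷w))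
        (λ t′ y ne → trans (values r t′ y) (wbOther t′ y ne)))
      (wellStamped-update (wellStamped r) (q<W t x ∷ ascending (wellStamped r) t x) fresh)

  flushes-back : ∀ σ σ′ σ₂′ → Represents σ′ σ₂′ → FLPSO σ σ′ →
    ∃ λ σ₂ → FLPP σ₂ σ₂′ × Represents σ σ₂
  flushes-back σ .σ σ₂′ r ε = σ₂′ , ε , r
  flushes-back σ σ′ σ₂′ r ((t , flush) ◅ flushes) with flushes-back _ σ′ σ₂′ r flushes
  ... | σ₂″ , flushes₂ , r″ with flush-back t σ _ σ₂″ r″ flush
  ...   | σ₂ , flush₂ , r₂ = σ₂ , (t , flush₂) ◅ flushes₂ , r₂

  transition-back : ∀ t a σ₁ σ₁′ σ₂′ → Represents σ₁′ σ₂′ → TPSO t a σ₁ σ₁′ →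
    ∃ λ σ₂ → TPP t a σ₂ σ₂′ × Represents σ₁ σ₂
  transition-back t a σ₁ σ₁′ σ₂′ r (σ , flushes , step) with step-back t a σ σ₁′ σ₂′ r step
  ... | σ₂ᵐ , step₂ , rᵐ with flushes-back σ₁ σ σ₂ᵐ rᵐ flushes
  ...   | σ₂ , flushes₂ , r₂ = σ₂ , (σ₂ᵐ , flushes₂ , step₂) , r₂

  represents-initial : ∀ σ₀ σ → IPSO σ₀ → Represents σ₀ σ → IPP σ
  represents-initial σ₀ σ empty r t x = map≡[]⇒≡[] _ (trans (values r t x) (empty t x))

  K : ℕ
  K = m ℕ.* n

  code : Tid → VarG → ℕ
  code t x = toℕ (combine t x)

  code<K : ∀ t x → code t x ℕ.< K
  code<K t x = toℕ<n (combine t x)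

  stampAt : Tid → VarG → ℕ → ℚ
  stampAt t x i = fromℕ (code t x ℕ.+ i ℕ.* K)

  stampAt-mono : ∀ t x {j i} → j ℕ.< i → stampAt t x j < stampAt t x i
  stampAt-mono t x j<i = fromℕ-mono-< (ℕP.+-monoʳ-< (code t x) (ℕP.*-monoˡ-< K j<i))
    where
    instance
      K≢0 : ℕ.NonZero K
      K≢0 = ℕ.>-nonZero (ℕP.m<n⇒0<n (code<K t x))

  stampAt-injective : ∀ t x t′ y j j′ → stampAt t x j ≡ stampAt t′ y j′ → t ≡ t′ × x ≡ y
  stampAt-injective t x t′ y j j′ eq =
    combine-injective t x t′ y (toℕ-injective
      (m+kn≡o+ln⇒m≡o {k = j} {l = j′} (code<K t x) (code<K t′ y) (fromℕ-injective eq)))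

  stamped : Tid → VarG → ℕ → List Val → List Entry
  stamped t x i []       = []
  stamped t x i (v ∷ vs) = (v , stampAt t x i) ∷ stamped t x (ℕ.suc i) vs

  stamped-values : ∀ t x i vs → map proj₁ (stamped t x i vs) ≡ vs
  stamped-values t x i []       = refl
  stamped-values t x i (v ∷ vs) = cong (v ∷_) (stamped-values t x (ℕ.suc i) vs)

  stamped-above : ∀ t x {j} i vs → j ℕ.< i → All (λ e → stampAt t x j < proj₂ e) (stamped t x i vs)
  stamped-above t x i []       _   = []
  stamped-above t x i (v ∷ vs) j<i =
    stampAt-mono t x j<i ∷ stamped-above t x (ℕ.suc i) vs (ℕP.m<n⇒m<1+n j<i)

  stamped-ascending : ∀ t x i vs → Ascending (stamped t x i vs)
  stamped-ascending t x i []       = []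
  stamped-ascending t x i (v ∷ vs) =
    stamped-above t x (ℕ.suc i) vs (ℕP.n<1+n i) ∷ stamped-ascending t x (ℕ.suc i) vs

  stamped-stamp : ∀ t x i vs {q} → HasStamp q (stamped t x i vs) → ∃ λ j → stampAt t x j ≡ q
  stamped-stamp t x i (v ∷ vs) (here eq) = i , eq
  stamped-stamp t x i (v ∷ vs) (there h) = stamped-stamp t x (ℕ.suc i) vs h

  represents-total : ∀ σ₁ → ∃ λ σ₂ → Represents σ₁ σ₂
  represents-total σ₁ = ⟨ s σ₁ , W ⟩ₚₚ ,
    represents (λ _ → refl) (λ t x → stamped-values t x 0 (wb σ₁ t x)) record
      { ascending = λ t x → stamped-ascending t x 0 (wb σ₁ t x)
      ; disjoint  = disjoint′
      }
    where
    W : Buffers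
    W t x = stamped t x 0 (wb σ₁ t x)

    disjoint′ : ∀ t x t′ y → ¬ (t′ ≡ t × y ≡ x) → ∀ {q} → HasStamp q (W t x) → ¬ HasStamp q (W t′ y)
    disjoint′ t x t′ y ne h h′ with stamped-stamp t x 0 _ h | stamped-stamp t′ y 0 _ h′
    ... | j , refl | j′ , eq′ with stampAt-injective t x t′ y j j′ (sym eq′)
    ...   | refl , refl = ne (refl , refl)

theorem2 : (m n : ℕ) (VarL Val : Set) →
    let open Model m n VarL Val in
    Σ (ΣPSO → ΣPP → Set) λ B →
        (∀ σ₁ → ∃ λ σ₂ → B σ₁ σ₂)
      × (∀ σ₀ σ → IPSO σ₀ → B σ₀ σ → IPP σ)
      × (∀ (t : Tid) (a : Act) σ₁ σ₁' σ₂' → B σ₁' σ₂' → TPSO t a σ₁ σ₁' →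
           ∃ λ σ₂ → TPP t a σ₂ σ₂' × B σ₁ σ₂)
theorem2 m n VarL Val = Represents , represents-total , represents-initial , transition-back
  where open BackwardSimulation m n VarL Val
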